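{- Let $a,b,c,d$ be non-negative integers with $ad-bc=1$. Then there exists a unique pair of non-negative integers $(m,n)$ with $0\le m\le 2^n-1$ such that \[ U(2^n:m)=\begin{pmatrix} a&b\\ c&d\end{pmatrix}. \]
   Context: Stern's diatomic integers: for integers $n\ge0$, $0\le m\le 2^n$, define $[2^0:0]=0$, $[2^0:1]=1$, $[2^{n+1}:2m]=[2^n:m]$ ($0\le m\le 2^n$), $[2^{n+1}:2m+1]=[2^n:m]+[2^n:m+1]$ ($0\le m\le 2^n-1$). For $0\le m\le 2^n-1$, the Stern's diatomic matrix is \[ U(2^n:m)=\begin{pmatrix}[2^n:m+1]&[2^n:m]\\ [2^n:2^n-(m+1)]&[2^n:2^n-m]\end{pmatrix}. \] -}

module Defs where

open import Data.Nat using (ℕ; zero; suc; _+_; _*_; _∸_; _^_; _<_)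
open import Data.Nat.DivMod using (_/_; _%_)
open import Data.Product using (_×_; _,_)
open import Relation.Binary.PropositionalEquality using (_≡_)

-- stern n m  represents Stern's diatomic integer [2^n : m], meaningful for 0 ≤ m ≤ 2^n.
-- (Values for m > 2^n are irrelevant junk and never used in the statement.)
stern : ℕ → ℕ → ℕ
stern zero zero = 0
stern zero (suc _) = 1
stern (suc n) m with m % 2
... | zero  = stern n (m / 2)
... | suc _ = stern n (m / 2) + stern n (m / 2 + 1)

-- 2x2 matrix of naturals, entries (top-left, top-right, bottom-left, bottom-right)
Mat2 : Set
Mat2 = ℕ × ℕ × ℕ × ℕ

mat : ℕ → ℕ → ℕ → ℕ → Mat2
mat a b c d = a , b , c , d

U : ℕ → ℕ → Mat2
U n m = mat (stern n (m + 1)) (stern n m)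
            (stern n (2 ^ n ∸ (m + 1))) (stern n (2 ^ n ∸ m))

-- Writing L = (1 0 ; 1 1) and R = (1 1 ; 0 1), the recursion for Stern's sequence
-- gives U(2^(n+1) : 2k) = U(2^n : k) L and U(2^(n+1) : 2k+1) = U(2^n : k) R, so
-- U(2^n : m) is the product of L's and R's spelled by the binary digits of m.
-- Conversely, comparing the columns of a unimodular matrix X over ℕ shows that either
-- X = I, or X = Y L, or X = Y R for a unimodular Y with smaller entry sum; iterating
-- gives existence. The two factorisations are disjoint and L, R cancel on the right,
-- which gives uniqueness.
module Submission where

open import Defs
open import Data.Nat
open import Data.Nat.Properties
open import Data.Nat.DivMod using (m*n%n≡0; m*n/n≡m; [m+kn]%n≡m%n; +-distrib-/-∣ʳ)
open import Data.Nat.Divisibility using (divides-refl)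
open import Data.Nat.Induction using (<-wellFounded)
open import Data.Nat.Tactic.RingSolver using (solve-∀)
open import Data.Product using (_×_; _,_; proj₁; proj₂; ∃; ∃₂)
open import Data.Sum using (_⊎_; inj₁; inj₂)
open import Data.Empty using (⊥; ⊥-elim)
open import Function.Base using (_on_)
open import Function.Bundles using (_⇔_; mk⇔; module Equivalence)
open Equivalence using (to; from)
open import Induction.WellFounded using (Acc; acc)
open import Relation.Binary.Construct.On as On using ()
open import Relation.Binary.PropositionalEquality
open import Relation.Nullary using (yes; no)

half-even : ∀ k → k * 2 / 2 ≡ k
half-even k = m*n/n≡m k 2

half-odd : ∀ k → (1 + k * 2) / 2 ≡ k
half-odd k = trans (+-distrib-/-∣ʳ 1 {d = 2} (divides-refl k)) (half-even k)

stern-even : ∀ n k → stern (suc n) (k * 2) ≡ stern n k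
stern-even n k rewrite m*n%n≡0 k 2 ⦃ _ ⦄ | half-even k = refl

stern-odd : ∀ n k → stern (suc n) (1 + k * 2) ≡ stern n k + stern n (suc k)
stern-odd n k rewrite [m+kn]%n≡m%n 1 k 2 ⦃ _ ⦄ | half-odd k =
  cong (λ x → stern n k + stern n x) (+-comm k 1)

I : Mat2
I = mat 1 0 0 1

-- X ·L and X ·R are the matrix products X (1 0 ; 1 1) and X (1 1 ; 0 1).
_·L : Mat2 → Mat2
(a , b , c , d) ·L = mat (a + b) b (c + d) d

_·R : Mat2 → Mat2
(a , b , c , d) ·R = mat a (a + b) c (c + d)

Unimodular : Mat2 → Set
Unimodular (a , b , c , d) = a * d ≡ 1 + b * c

weight : Mat2 → ℕ
weight (a , b , c , d) = a + b + c + d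

IsSternMatrix : Mat2 → Set
IsSternMatrix X = ∃₂ λ m n → m < 2 ^ n × U n m ≡ X

mat-cong : ∀ {a b c d a′ b′ c′ d′} →
  a ≡ a′ → b ≡ b′ → c ≡ c′ → d ≡ d′ → mat a b c d ≡ mat a′ b′ c′ d′
mat-cong refl refl refl refl = refl

mat-injective : ∀ {a b c d a′ b′ c′ d′} →
  mat a b c d ≡ mat a′ b′ c′ d′ → a ≡ a′ × b ≡ b′ × c ≡ c′ × d ≡ d′
mat-injective refl = refl , refl , refl , refl

half-< : ∀ k p → k * 2 < 2 * p → k < p
half-< k p lt = *-cancelʳ-< 2 k p (subst (k * 2 <_) (*-comm 2 p) lt)

double+1-< : ∀ k p → k < p → 1 + k * 2 < 2 * p
double+1-< k p lt = subst (suc k * 2 ≤_) (*-comm p 2) (*-monoˡ-≤ 2 lt)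

U-complement : ∀ n k j → k + suc j ≡ 2 ^ n →
  U n k ≡ mat (stern n (suc k)) (stern n k) (stern n j) (stern n (suc j))
U-complement n k j e rewrite sym e =
  mat-cong (cong (stern n) (+-comm k 1)) refl
           (cong (stern n) (trans (cong (_∸ (k + 1)) (shift k j)) (m+n∸m≡n (k + 1) j)))
           (cong (stern n) (m+n∸m≡n k (suc j)))
  where
  shift : ∀ k j → k + suc j ≡ k + 1 + j
  shift = solve-∀

complement : ∀ {k p} → k < p → ∃ λ j → k + suc j ≡ p
complement {k} lt with m≤n⇒∃[o]m+o≡n lt
... | j , e = j , trans (+-suc k j) e

U-even : ∀ n {k} → k < 2 ^ n → U (suc n) (k * 2) ≡ U n k ·L
U-even n {k} k< with complement k<
... | j , e = begin
  U (suc n) (k * 2)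
    ≡⟨ U-complement (suc n) (k * 2) (1 + j * 2) (trans (doubled k j) (cong (2 *_) e)) ⟩
  mat (stern (suc n) (1 + k * 2)) (stern (suc n) (k * 2))
      (stern (suc n) (1 + j * 2)) (stern (suc n) (suc j * 2))
    ≡⟨ mat-cong (trans (stern-odd n k) (+-comm (stern n k) _)) (stern-even n k)
                (stern-odd n j) (stern-even n (suc j)) ⟩
  mat (stern n (suc k)) (stern n k) (stern n j) (stern n (suc j)) ·L
    ≡⟨ cong _·L (U-complement n k j e) ⟨
  U n k ·L ∎
  where
  open ≡-Reasoning
  doubled : ∀ k j → k * 2 + suc (1 + j * 2) ≡ 2 * (k + suc j)
  doubled = solve-∀

U-odd : ∀ n {k} → k < 2 ^ n → U (suc n) (1 + k * 2) ≡ U n k ·R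
U-odd n {k} k< with complement k<
... | j , e = begin
  U (suc n) (1 + k * 2)
    ≡⟨ U-complement (suc n) (1 + k * 2) (j * 2) (trans (doubled k j) (cong (2 *_) e)) ⟩
  mat (stern (suc n) (suc k * 2)) (stern (suc n) (1 + k * 2))
      (stern (suc n) (j * 2)) (stern (suc n) (1 + j * 2))
    ≡⟨ mat-cong (stern-even n (suc k)) (trans (stern-odd n k) (+-comm (stern n k) _))
                (stern-even n j) (stern-odd n j) ⟩
  mat (stern n (suc k)) (stern n k) (stern n j) (stern n (suc j)) ·R
    ≡⟨ cong _·R (U-complement n k j e) ⟨
  U n k ·R ∎
  where
  open ≡-Reasoning
  doubled : ∀ k j → 1 + k * 2 + suc (j * 2) ≡ 2 * (k + suc j)
  doubled = solve-∀

data SternStep (n : ℕ) : ℕ → Set where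
  via-L : ∀ {k} → k < 2 ^ n → SternStep n (k * 2)
  via-R : ∀ {k} → k < 2 ^ n → SternStep n (1 + k * 2)

data ParityView : ℕ → Set where
  even : ∀ k → ParityView (k * 2)
  odd  : ∀ k → ParityView (1 + k * 2)

parityView : ∀ m → ParityView m
parityView zero = even 0
parityView (suc m) with parityView m
... | even k = odd k
... | odd k  = even (suc k)

sternStep : ∀ n {m} → m < 2 ^ suc n → SternStep n m
sternStep n {m} m< with parityView m
... | even k = via-L (half-< k (2 ^ n) m<)
... | odd k  = via-R (half-< k (2 ^ n) (<⇒≤ m<))

U-zero : ∀ {m} → m < 2 ^ 0 → U 0 m ≡ I
U-zero {zero} _ = refl
U-zero {suc _} (s≤s ())

·L-unimodular : ∀ {X} → Unimodular (X ·L) ⇔ Unimodular X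
·L-unimodular {a , b , c , d} = mk⇔
  (λ e → +-cancelʳ-≡ (b * d) _ _ (trans (sym lhs) (trans e rhs)))
  (λ e → trans lhs (trans (cong (_+ b * d) e) (sym rhs)))
  where
  lhs : (a + b) * d ≡ a * d + b * d
  lhs = *-distribʳ-+ d a b
  rhs : 1 + b * (c + d) ≡ 1 + b * c + b * d
  rhs = cong suc (*-distribˡ-+ b c d)

·R-unimodular : ∀ {X} → Unimodular (X ·R) ⇔ Unimodular X
·R-unimodular {a , b , c , d} = mk⇔
  (λ e → +-cancelʳ-≡ (a * c) _ _ (trans (sym lhs) (trans e rhs)))
  (λ e → trans lhs (trans (cong (_+ a * c) e) (sym rhs)))
  where
  lhs : a * (c + d) ≡ a * d + a * c
  lhs = trans (*-distribˡ-+ a c d) (+-comm (a * c) (a * d))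
  rhs : 1 + (a + b) * c ≡ 1 + b * c + a * c
  rhs = cong suc (trans (*-distribʳ-+ c a b) (+-comm (a * c) (b * c)))

U-unimodular : ∀ n {m} → m < 2 ^ n → Unimodular (U n m)
U-unimodular zero {zero} _ = refl
U-unimodular zero {suc _} (s≤s ())
U-unimodular (suc n) m< with sternStep n m<
... | via-L {k} k< = subst Unimodular (sym (U-even n k<))
                           (from (·L-unimodular {U n k}) (U-unimodular n k<))
... | via-R {k} k< = subst Unimodular (sym (U-odd n k<))
                           (from (·R-unimodular {U n k}) (U-unimodular n k<))

diagonal-positive : ∀ a b c d → Unimodular (mat a b c d) → 0 < a × 0 < d
diagonal-positive zero _ _ _ ()
diagonal-positive (suc a) _ _ zero u = ⊥-elim (1+n≢0 (trans (sym u) (*-zeroʳ (suc a))))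
diagonal-positive (suc a) _ _ (suc d) u = z<s , z<s

·L≢I : ∀ X → X ·L ≢ I
·L≢I (a , b , c , d) e with mat-injective e
... | _ , _ , c+d≡0 , refl = 1+n≢0 (m+n≡0⇒n≡0 c c+d≡0)

·R≢I : ∀ X → X ·R ≢ I
·R≢I (a , b , c , d) e with mat-injective e
... | refl , a+b≡0 , _ , _ = 1+n≢0 (m+n≡0⇒m≡0 1 a+b≡0)

·L-injective : ∀ X Y → X ·L ≡ Y ·L → X ≡ Y
·L-injective (a , b , c , d) (a′ , b′ , c′ , d′) e with mat-injective e
... | ea , refl , ec , refl = mat-cong (+-cancelʳ-≡ b a a′ ea) refl (+-cancelʳ-≡ d c c′ ec) refl

·R-injective : ∀ X Y → X ·R ≡ Y ·R → X ≡ Y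
·R-injective (a , b , c , d) (a′ , b′ , c′ , d′) e with mat-injective e
... | refl , eb , refl , ed = mat-cong refl (+-cancelˡ-≡ a b b′ eb) refl (+-cancelˡ-≡ c d d′ ed)

-- Comparing top rows: a + b = a′ and b = a′ + b′ force a = 0, against unimodularity.
·L≢·R : ∀ X Y → Unimodular X → X ·L ≢ Y ·R
·L≢·R (a , b , c , d) (a′ , b′ , c′ , d′) u e with mat-injective e | diagonal-positive a b c d u
... | ea , eb , _ , _ | 0<a , _ = <-irrefl refl (begin-strict
  a′             <⟨ m<n+m a′ 0<a ⟩
  a + a′         ≤⟨ +-monoʳ-≤ a (m≤m+n a′ b′) ⟩
  a + (a′ + b′)  ≡⟨ cong (a +_) eb ⟨
  a + b          ≡⟨ ea ⟩
  a′             ∎)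
  where open ≤-Reasoning

U-suc≢I : ∀ n {m} → m < 2 ^ suc n → U (suc n) m ≢ I
U-suc≢I n m< with sternStep n m<
... | via-L k< = λ e → ·L≢I _ (trans (sym (U-even n k<)) e)
... | via-R k< = λ e → ·R≢I _ (trans (sym (U-odd n k<)) e)

U-injective : ∀ n n′ {m m′} → m < 2 ^ n → m′ < 2 ^ n′ → U n m ≡ U n′ m′ → (m , n) ≡ (m′ , n′)
U-injective zero zero {zero} {zero} _ _ _ = refl
U-injective zero zero {suc _} (s≤s ()) _ _
U-injective zero zero {_} {suc _} _ (s≤s ()) _
U-injective zero (suc n′) m< m′< e = ⊥-elim (U-suc≢I n′ m′< (trans (sym e) (U-zero m<)))
U-injective (suc n) zero m< m′< e = ⊥-elim (U-suc≢I n m< (trans e (U-zero m′<)))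
U-injective (suc n) (suc n′) m< m′< e with sternStep n m< | sternStep n′ m′<
... | via-L k< | via-L k′< = cong (λ (k , l) → k * 2 , suc l)
  (U-injective n n′ k< k′< (·L-injective _ _ (trans (sym (U-even n k<)) (trans e (U-even n′ k′<)))))
... | via-R k< | via-R k′< = cong (λ (k , l) → 1 + k * 2 , suc l)
  (U-injective n n′ k< k′< (·R-injective _ _ (trans (sym (U-odd n k<)) (trans e (U-odd n′ k′<)))))
... | via-L k< | via-R k′< =
  ⊥-elim (·L≢·R _ _ (U-unimodular n k<) (trans (sym (U-even n k<)) (trans e (U-odd n′ k′<))))
... | via-R k< | via-L k′< =
  ⊥-elim (·L≢·R _ _ (U-unimodular n′ k′<) (trans (sym (U-even n′ k′<)) (trans (sym e) (U-odd n k<))))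

off-diagonal-zero : ∀ a b c d → Unimodular (mat a b c d) → b < a → c < d → b + c ≡ 0
off-diagonal-zero a b c d u b<a c<d = n≤0⇒n≡0 (+-cancelˡ-≤ (1 + b * c) (b + c) 0 (begin
  1 + b * c + (b + c)  ≡⟨ expand b c ⟩
  suc b * suc c        ≤⟨ *-mono-≤ b<a c<d ⟩
  a * d                ≡⟨ u ⟩
  1 + b * c            ≡⟨ +-identityʳ _ ⟨
  1 + b * c + 0        ∎))
  where
  open ≤-Reasoning
  expand : ∀ b c → 1 + b * c + (b + c) ≡ suc b * suc c
  expand = solve-∀

unimodular-diagonal : ∀ a b c d → Unimodular (mat a b c d) → b < a → c < d → mat a b c d ≡ I
unimodular-diagonal a b c d u b<a c<d with off-diagonal-zero a b c d u b<a c<d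
... | b+c≡0 with m+n≡0⇒m≡0 b b+c≡0 | m+n≡0⇒n≡0 b b+c≡0
... | refl | refl = mat-cong (m*n≡1⇒m≡1 a d u) refl refl (m*n≡1⇒n≡1 a d u)

unimodular-antidiagonal : ∀ a b c d → Unimodular (mat a b c d) → a < b → d < c → ⊥
unimodular-antidiagonal a b c d u a<b d<c = <-irrefl refl (begin-strict
  b * c          <⟨ n<1+n (b * c) ⟩
  1 + b * c      ≡⟨ u ⟨
  a * d          ≤⟨ *-monoʳ-≤ a (n≤1+n d) ⟩
  a * suc d      <⟨ m<n+m (a * suc d) z<s ⟩
  suc a * suc d  ≤⟨ *-mono-≤ a<b d<c ⟩
  b * c          ∎)
  where open ≤-Reasoning

unimodular-columns : ∀ a b c d → Unimodular (mat a b c d) →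
  (b ≤ a × d ≤ c) ⊎ (a ≤ b × c ≤ d) ⊎ mat a b c d ≡ I
unimodular-columns a b c d u with b ≤? a | d ≤? c
... | yes b≤a | yes d≤c = inj₁ (b≤a , d≤c)
... | no b≰a  | no d≰c  = inj₂ (inj₁ (<⇒≤ (≰⇒> b≰a) , <⇒≤ (≰⇒> d≰c)))
... | yes b≤a | no d≰c with a ≤? b
...   | yes a≤b = inj₂ (inj₁ (a≤b , <⇒≤ (≰⇒> d≰c)))
...   | no a≰b  = inj₂ (inj₂ (unimodular-diagonal a b c d u (≰⇒> a≰b) (≰⇒> d≰c)))
unimodular-columns a b c d u | no b≰a | yes d≤c with c ≤? d
...   | yes c≤d = inj₂ (inj₁ (<⇒≤ (≰⇒> b≰a) , c≤d))
...   | no c≰d  = ⊥-elim (unimodular-antidiagonal a b c d u (≰⇒> b≰a) (≰⇒> c≰d))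

unimodular-descent : ∀ X → Unimodular X →
  X ≡ I ⊎ ∃ λ Y → Unimodular Y × (X ≡ Y ·L ⊎ X ≡ Y ·R)
unimodular-descent (a , b , c , d) u with unimodular-columns a b c d u
... | inj₁ (b≤a , d≤c) =
  inj₂ (Y , to (·L-unimodular {Y}) (subst Unimodular X≡Y·L u) , inj₁ X≡Y·L)
  where
  Y : Mat2
  Y = mat (a ∸ b) b (c ∸ d) d
  X≡Y·L : mat a b c d ≡ Y ·L
  X≡Y·L = mat-cong (sym (m∸n+n≡m b≤a)) refl (sym (m∸n+n≡m d≤c)) refl
... | inj₂ (inj₁ (a≤b , c≤d)) =
  inj₂ (Y , to (·R-unimodular {Y}) (subst Unimodular X≡Y·R u) , inj₂ X≡Y·R)
  where
  Y : Mat2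
  Y = mat a (b ∸ a) c (d ∸ c)
  X≡Y·R : mat a b c d ≡ Y ·R
  X≡Y·R = mat-cong refl (sym (m+[n∸m]≡n a≤b)) refl (sym (m+[n∸m]≡n c≤d))
... | inj₂ (inj₂ X≡I) = inj₁ X≡I

weight-·L : ∀ Y → Unimodular Y → weight Y < weight (Y ·L)
weight-·L (a , b , c , d) u = begin-strict
  a + b + c + d              <⟨ m<m+n _ (<-≤-trans 0<d (m≤n+m d b)) ⟩
  a + b + c + d + (b + d)    ≡⟨ regroup a b c d ⟩
  a + b + b + (c + d) + d    ∎
  where
  open ≤-Reasoning
  0<d : 0 < d
  0<d = proj₂ (diagonal-positive a b c d u)
  regroup : ∀ a b c d → a + b + c + d + (b + d) ≡ a + b + b + (c + d) + d
  regroup = solve-∀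

weight-·R : ∀ Y → Unimodular Y → weight Y < weight (Y ·R)
weight-·R (a , b , c , d) u = begin-strict
  a + b + c + d              <⟨ m<m+n _ (<-≤-trans 0<a (m≤m+n a c)) ⟩
  a + b + c + d + (a + c)    ≡⟨ regroup a b c d ⟩
  a + (a + b) + c + (c + d)  ∎
  where
  open ≤-Reasoning
  0<a : 0 < a
  0<a = proj₁ (diagonal-positive a b c d u)
  regroup : ∀ a b c d → a + b + c + d + (a + c) ≡ a + (a + b) + c + (c + d)
  regroup = solve-∀

·L-sternMatrix : ∀ {X} → IsSternMatrix X → IsSternMatrix (X ·L)
·L-sternMatrix (k , n , k< , refl) = k * 2 , suc n , <⇒≤ (double+1-< k (2 ^ n) k<) , U-even n k<

·R-sternMatrix : ∀ {X} → IsSternMatrix X → IsSternMatrix (X ·R)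
·R-sternMatrix (k , n , k< , refl) = 1 + k * 2 , suc n , double+1-< k (2 ^ n) k< , U-odd n k<

unimodular⇒sternMatrix : ∀ X → Unimodular X → IsSternMatrix X
unimodular⇒sternMatrix X = go X (On.wellFounded weight <-wellFounded X)
  where
  go : ∀ X → Acc (_<_ on weight) X → Unimodular X → IsSternMatrix X
  go X (acc rs) u with unimodular-descent X u
  ... | inj₁ refl = 0 , 0 , z<s , refl
  ... | inj₂ (Y , uY , inj₁ refl) = ·L-sternMatrix (go Y (rs (weight-·L Y uY)) uY)
  ... | inj₂ (Y , uY , inj₂ refl) = ·R-sternMatrix (go Y (rs (weight-·R Y uY)) uY)

theorem5p4 : (a b c d : ℕ) → a * d ≡ 1 + b * c →
    ∃ (λ (mn : ℕ × ℕ) → let (m , n) = mn in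
      (m < 2 ^ n × U n m ≡ mat a b c d)
      × ((m' n' : ℕ) → m' < 2 ^ n' → U n' m' ≡ mat a b c d → (m' , n') ≡ (m , n)))
theorem5p4 a b c d u with unimodular⇒sternMatrix (mat a b c d) u
... | m , n , m< , Um≡X =
  (m , n) , (m< , Um≡X) , λ m′ n′ m′< Um′≡X → U-injective n′ n m′< m< (trans Um′≡X (sym Um≡X))
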